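{- Let $n\geq 4$, $k\geq 5$, and let $f_1^{n,k},\dots,f_n^{n,k}$ be a valid dynamic task allocation with maximum switching cost at most $2$. For any demand vector $\vec v$ with at least four non-zero entries, there is at most one task of type 1 with respect to $\vec v$.
   Context: A demand vector for $n$ agents and $k$ tasks is $\vec v=(v_1,\dots,v_k)$ of non-negative integers summing to $n$. A valid dynamic task allocation is a family of functions $f_1^{n,k},\dots,f_n^{n,k}$ from demand vectors to $[k]$ such that for every $\vec v$ and task $j$, exactly $v_j$ agents $a$ have $f_a^{n,k}(\vec v)=j$. The switching cost of $(\vec v,\vec v')$ is the number of agents $a$ with $f_a^{n,k}(\vec v)\neq f_a^{n,k}(\vec v')$; the maximum switching cost is its maximum over pairs at $\ell_1$ distance $2$. A task $t$ is of type 1 with respect to $\vec v$ if moving a unit of demand in $\vec v$ from any task to $t$ yields a demand vector $\vec v'$ such that $(\vec v,\vec v')$ has switching cost $1$. -}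

module Defs where

open import Data.Nat using (ℕ; zero; suc; _+_; _∸_; ∣_-_∣; _≤_; _<_)
open import Data.Fin using (Fin; zero; suc; _≟_)
open import Data.Product using (Σ; _,_; proj₁; _×_)
open import Relation.Nullary using (Dec; yes; no; ¬_)
open import Relation.Binary.PropositionalEquality using (_≡_)

Σᶠ : {k : ℕ} → (Fin k → ℕ) → ℕ
Σᶠ {zero} g = 0
Σᶠ {suc k} g = g zero + Σᶠ {k} (λ i → g (suc i))

count : {n : ℕ} {P : Fin n → Set} → ((a : Fin n) → Dec (P a)) → ℕ
count {zero} d = 0
count {suc n} d with d zero
... | yes _ = suc (count {n} (λ a → d (suc a)))
... | no  _ = count {n} (λ a → d (suc a))

DemandVec : ℕ → ℕ → Set
DemandVec n k = Σ (Fin k → ℕ) (λ v → Σᶠ v ≡ n)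

dist : {n k : ℕ} → DemandVec n k → DemandVec n k → ℕ
dist (v , _) (w , _) = Σᶠ (λ i → ∣ v i - w i ∣)

Allocation : ℕ → ℕ → Set
Allocation n k = Fin n → DemandVec n k → Fin k

load : {n k : ℕ} → Allocation n k → DemandVec n k → Fin k → ℕ
load f v j = count (λ a → f a v ≟ j)

Valid : {n k : ℕ} → Allocation n k → Set
Valid {n} {k} f = (v : DemandVec n k) (j : Fin k) → load f v j ≡ proj₁ v j

switchCost : {n k : ℕ} → Allocation n k → DemandVec n k → DemandVec n k → ℕ
switchCost f v v' = count (λ a → ¬? (f a v ≟ f a v'))
  where
  open import Relation.Nullary using (¬?)

MaxSwitchCostAtMost : {n k : ℕ} → Allocation n k → ℕ → Set
MaxSwitchCostAtMost {n} {k} f c =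
  (v v' : DemandVec n k) → dist v v' ≡ 2 → switchCost f v v' ≤ c

nonZeroCount : {n k : ℕ} → DemandVec n k → ℕ
nonZeroCount (v , _) = count (λ i → 0 <? v i)
  where
  open import Data.Nat using (_<?_)

MovesUnit : {n k : ℕ} → DemandVec n k → Fin k → Fin k → DemandVec n k → Set
MovesUnit {n} {k} (v , _) s t (w , _) =
  (w s ≡ v s ∸ 1) × (w t ≡ suc (v t)) ×
  ((i : Fin k) → ¬ i ≡ s → ¬ i ≡ t → w i ≡ v i)

Type1 : {n k : ℕ} → Allocation n k → DemandVec n k → Fin k → Set
Type1 {n} {k} f v t =
  (s : Fin k) → ¬ s ≡ t → 0 < proj₁ v s →
  (v' : DemandVec n k) → MovesUnit v s t v' → switchCost f v v' ≡ 1

-- Let t ≠ t' both be of type 1. Moving a unit of demand from a task s into a type-1 task T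
-- relocates exactly one agent a_s, from s to T. Moving one more unit, from s' to a spare task z,
-- gives an allocation within switching cost 2 of both one-step allocations, and load counting
-- forces it to be a double move: a_s and a_s' go to T, after which one agent ζ (one of them, or
-- an agent already at T) goes on to z. For three sources s₁, s₂, s₃ the three double moves are
-- pairwise at distance 2, which pins their ζ down to a single agent γ originally at T. The double
-- move from s₁, s₂ towards t' instead of T is again at distance 2 from the one towards T, yet the
-- two allocations disagree at a_s₁, a_s₂ and γ. Four non-zero entries and k ≥ 5 supply s₁, s₂, s₃, z.

module Submission where

open import Defs
open import Data.Nat using (ℕ; zero; suc; _+_; _∸_; _≤_; _<_; z≤n; s≤s; ∣_-_∣; _<?_; >-nonZero)
import Data.Nat.Properties as ℕ
open import Algebra.Properties.CommutativeSemigroup ℕ.+-commutativeSemigroup using (xy∙z≈xz∙y; interchange)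
open import Data.Nat.Solver using (module +-*-Solver)
open import Data.Fin using (Fin; zero; suc; _≟_)
open import Data.Fin.Properties using (suc-injective; ¬∀⟶∃¬)
open import Data.List using (List; []; _∷_; length)
open import Data.List.Membership.Propositional using (_∉_)
open import Data.List.Relation.Unary.All as All using (All; []; _∷_)
open import Data.List.Relation.Unary.Any using (here; there; any?; toSum)
open import Data.List.Relation.Unary.Unique.Propositional using (Unique; []; _∷_)
open import Data.Product using (Σ; ∃; _×_; _,_; proj₁; proj₂)
open import Data.Sum using (_⊎_; inj₁; inj₂; [_,_])
import Data.Sum as Sum
open import Function using (_∘_)
open import Data.Empty using (⊥; ⊥-elim)
open import Data.Unit using (tt)
open import Relation.Nullary using (Dec; yes; no; ¬_; ¬?; contradiction)
open import Relation.Nullary.Decidable using (_×-dec_; _⊎-dec_; _→-dec_)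
open import Relation.Binary.PropositionalEquality
  using (_≡_; _≢_; refl; sym; trans; cong; cong₂; subst; ≢-sym; module ≡-Reasoning)

private variable
  n k : ℕ

-- Counting

count-mono : {P Q : Fin n → Set} (P? : ∀ a → Dec (P a)) (Q? : ∀ a → Dec (Q a)) →
             (∀ a → P a → Q a) → count P? ≤ count Q?
count-mono {zero}  P? Q? P⊆Q = z≤n
count-mono {suc n} P? Q? P⊆Q with P? zero | Q? zero
... | yes _ | yes _  = s≤s (count-mono (λ a → P? (suc a)) (λ a → Q? (suc a)) (λ a → P⊆Q (suc a)))
... | yes p | no ¬q  = contradiction (P⊆Q zero p) ¬q
... | no _  | yes _  = ℕ.m≤n⇒m≤1+n (count-mono (λ a → P? (suc a)) (λ a → Q? (suc a)) (λ a → P⊆Q (suc a)))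
... | no _  | no _   = count-mono (λ a → P? (suc a)) (λ a → Q? (suc a)) (λ a → P⊆Q (suc a))

count-insert : {P Q : Fin n → Set} (P? : ∀ a → Dec (P a)) (Q? : ∀ a → Dec (Q a)) →
               (∀ a → P a → Q a) → (α : Fin n) → Q α → ¬ P α → suc (count P?) ≤ count Q?
count-insert {suc n} P? Q? P⊆Q zero qα ¬pα with P? zero | Q? zero
... | yes pα | _     = contradiction pα ¬pα
... | no _   | yes _ = s≤s (count-mono (λ a → P? (suc a)) (λ a → Q? (suc a)) (λ a → P⊆Q (suc a)))
... | no _   | no ¬q = contradiction qα ¬q
count-insert {suc n} P? Q? P⊆Q (suc α) qα ¬pα with P? zero | Q? zero
... | yes _ | yes _  = s≤s (count-insert (λ a → P? (suc a)) (λ a → Q? (suc a)) (λ a → P⊆Q (suc a)) α qα ¬pα)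
... | yes p | no ¬q  = contradiction (P⊆Q zero p) ¬q
... | no _  | yes _  = ℕ.m≤n⇒m≤1+n (count-insert (λ a → P? (suc a)) (λ a → Q? (suc a)) (λ a → P⊆Q (suc a)) α qα ¬pα)
... | no _  | no _   = count-insert (λ a → P? (suc a)) (λ a → Q? (suc a)) (λ a → P⊆Q (suc a)) α qα ¬pα

count-none : {P : Fin n → Set} (P? : ∀ a → Dec (P a)) → (∀ a → ¬ P a) → count P? ≡ 0
count-none {zero}  P? ¬P = refl
count-none {suc n} P? ¬P with P? zero
... | yes p = contradiction p (¬P zero)
... | no _  = count-none (λ a → P? (suc a)) (λ a → ¬P (suc a))

count-all : {P : Fin n → Set} (P? : ∀ a → Dec (P a)) → (∀ a → P a) → count P? ≡ n
count-all {zero}  P? allP = refl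
count-all {suc n} P? allP with P? zero
... | yes _ = cong suc (count-all (λ a → P? (suc a)) (λ a → allP (suc a)))
... | no ¬p = contradiction (allP zero) ¬p

count-⊎ : {P Q : Fin n → Set} (P? : ∀ a → Dec (P a)) (Q? : ∀ a → Dec (Q a)) →
          count (λ a → P? a ⊎-dec Q? a) ≤ count P? + count Q?
count-⊎ {zero}  P? Q? = z≤n
count-⊎ {suc n} P? Q? with P? zero | Q? zero
... | yes _ | yes _ = s≤s (ℕ.≤-trans (count-⊎ (λ a → P? (suc a)) (λ a → Q? (suc a)))
                                     (ℕ.+-monoʳ-≤ (count (λ a → P? (suc a))) (ℕ.n≤1+n _)))
... | yes _ | no _  = s≤s (count-⊎ (λ a → P? (suc a)) (λ a → Q? (suc a)))
... | no _  | yes _ = ℕ.≤-trans (s≤s (count-⊎ (λ a → P? (suc a)) (λ a → Q? (suc a))))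
                                (ℕ.≤-reflexive (sym (ℕ.+-suc _ _)))
... | no _  | no _  = count-⊎ (λ a → P? (suc a)) (λ a → Q? (suc a))

count-≡ : (c : Fin n) → count (λ a → a ≟ c) ≤ 1
count-≡ {suc n} zero = s≤s (ℕ.≤-reflexive (count-none {n} (λ a → suc a ≟ zero) (λ a ())))
count-≡ {suc n} (suc c) =
  ℕ.≤-trans (count-mono (λ a → suc a ≟ suc c) (λ a → a ≟ c) (λ a → suc-injective)) (count-≡ c)

count-∈ : (xs : List (Fin n)) → count (λ a → any? (a ≟_) xs) ≤ length xs
count-∈ {n} [] = ℕ.≤-reflexive (count-none {n} (λ a → any? (a ≟_) []) (λ a ()))
count-∈ (x ∷ xs) = begin
  count (λ a → any? (a ≟_) (x ∷ xs))          ≤⟨ count-mono _ (λ a → (a ≟ x) ⊎-dec any? (a ≟_) xs) (λ a → toSum) ⟩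
  count (λ a → (a ≟ x) ⊎-dec any? (a ≟_) xs)  ≤⟨ count-⊎ (_≟ x) (λ a → any? (a ≟_) xs) ⟩
  count (_≟ x) + count (λ a → any? (a ≟_) xs) ≤⟨ ℕ.+-mono-≤ (count-≡ x) (count-∈ xs) ⟩
  suc (length xs)                             ∎
  where open ℕ.≤-Reasoning

count-≥-length : {P : Fin n → Set} (P? : ∀ a → Dec (P a)) (xs : List (Fin n)) →
                 Unique xs → All P xs → length xs ≤ count P?
count-≥-length P? [] _ _ = z≤n
count-≥-length {P = P} P? (x ∷ xs) (x∉xs ∷ unique) (px ∷ pxs) = ℕ.≤-trans
  (s≤s (count-≥-length P?∖x xs unique (All.zip (pxs , All.map (λ x≢a a≡x → x≢a (sym a≡x)) x∉xs))))
  (count-insert P?∖x P? (λ _ → proj₁) x px (λ (_ , x≢x) → x≢x refl))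
  where
  P?∖x : ∀ a → Dec (P a × a ≢ x)
  P?∖x a = P? a ×-dec ¬? (a ≟ x)

⊈⇒∃ : {P Q : Fin n → Set} (P? : ∀ a → Dec (P a)) (Q? : ∀ a → Dec (Q a)) →
       ¬ (∀ a → P a → Q a) → ∃ λ a → P a × ¬ Q a
⊈⇒∃ {n} P? Q? P⊈Q with ¬∀⟶∃¬ n _ (λ a → P? a →-dec Q? a) P⊈Q
... | a , ¬P⇒Q with P? a
...   | yes pa = a , pa , λ qa → ¬P⇒Q (λ _ → qa)
...   | no ¬pa = contradiction (λ pa → contradiction pa ¬pa) ¬P⇒Q

count-<⇒∃ : {P Q : Fin n → Set} (P? : ∀ a → Dec (P a)) (Q? : ∀ a → Dec (Q a)) →
            count P? < count Q? → ∃ λ a → Q a × ¬ P a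
count-<⇒∃ P? Q? lt = ⊈⇒∃ Q? P? (λ Q⊆P → ℕ.<⇒≱ lt (count-mono Q? P? Q⊆P))

count-pos⇒∃ : {P : Fin n → Set} (P? : ∀ a → Dec (P a)) → 0 < count P? → ∃ P
count-pos⇒∃ {suc n} P? pos with P? zero
... | yes p = zero , p
... | no _  = let a , pa = count-pos⇒∃ (λ a → P? (suc a)) pos in suc a , pa

count-≤suc⇒∃ : {P Q : Fin n → Set} (P? : ∀ a → Dec (P a)) (Q? : ∀ a → Dec (Q a)) →
               count Q? ≤ suc (count P?) → {a b : Fin n} → a ≢ b →
               Q a → ¬ P a → Q b → ¬ P b → ∃ λ c → P c × ¬ Q c
count-≤suc⇒∃ {P = P} {Q} P? Q? le {a} {b} a≢b qa ¬pa qb ¬pb = ⊈⇒∃ P? Q? λ P⊆Q →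
  ℕ.<⇒≱ (count-insert P?∪a P?∪a∪b (λ _ → inj₁) b (inj₂ refl) ¬P∪a-b)
    (ℕ.≤-trans (count-mono P?∪a∪b Q? (P∪a∪b⊆Q P⊆Q))
       (ℕ.≤-trans le (count-insert P? P?∪a (λ _ → inj₁) a (inj₂ refl) ¬pa)))
  where
  P?∪a = λ c → P? c ⊎-dec (c ≟ a)
  P?∪a∪b = λ c → P?∪a c ⊎-dec (c ≟ b)
  P∪a∪b⊆Q : (∀ c → P c → Q c) → ∀ c → (P c ⊎ c ≡ a) ⊎ c ≡ b → Q c
  P∪a∪b⊆Q P⊆Q c (inj₁ (inj₁ pc)) = P⊆Q c pc
  P∪a∪b⊆Q P⊆Q c (inj₁ (inj₂ refl)) = qa
  P∪a∪b⊆Q P⊆Q c (inj₂ refl) = qb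
  ¬P∪a-b : ¬ (P b ⊎ b ≡ a)
  ¬P∪a-b (inj₁ pb) = ¬pb pb
  ¬P∪a-b (inj₂ b≡a) = a≢b (sym b≡a)

fresh : {P : Fin n → Set} (P? : ∀ a → Dec (P a)) (xs : List (Fin n)) →
        length xs < count P? → ∃ λ a → P a × a ∉ xs
fresh P? xs lt = count-<⇒∃ (λ a → any? (a ≟_) xs) P? (ℕ.≤-<-trans (count-∈ xs) lt)

-- Shifts of demand

δ : Fin k → Fin k → ℕ
δ i j with i ≟ j
... | yes _ = 1
... | no _  = 0

δ-refl : (i : Fin k) → δ i i ≡ 1
δ-refl i with i ≟ i
... | yes _  = refl
... | no i≢i = contradiction refl i≢i

δ-≢ : {i j : Fin k} → i ≢ j → δ i j ≡ 0
δ-≢ {i = i} {j} i≢j with i ≟ j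
... | yes i≡j = contradiction i≡j i≢j
... | no _    = refl

+δ-refl : (m : ℕ) (i : Fin k) → m + δ i i ≡ suc m
+δ-refl m i = trans (cong (m +_) (δ-refl i)) (ℕ.+-comm m 1)

+δ-≢ : (m : ℕ) {i j : Fin k} → i ≢ j → m + δ i j ≡ m
+δ-≢ m i≢j = trans (cong (m +_) (δ-≢ i≢j)) (ℕ.+-identityʳ m)

-- Shift u w p q says w = u - e_p + e_q and Shift₂ u w p q x z says w = u - e_p - e_q + e_x + e_z,
-- both stated additively to avoid truncated subtraction.
Shift : (u w : Fin k → ℕ) → Fin k → Fin k → Set
Shift u w p q = ∀ i → w i + δ i p ≡ u i + δ i q

Shift₂ : (u w : Fin k → ℕ) → Fin k → Fin k → Fin k → Fin k → Set
Shift₂ u w p q x z = ∀ i → w i + δ i p + δ i q ≡ u i + δ i x + δ i z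

module _ {u w : Fin k → ℕ} {p q : Fin k} (p≢q : p ≢ q) (u→w : Shift u w p q) where

  shift-source : u p ≡ suc (w p)
  shift-source = begin
    u p          ≡⟨ +δ-≢ (u p) p≢q ⟨
    u p + δ p q  ≡⟨ u→w p ⟨
    w p + δ p p  ≡⟨ +δ-refl (w p) p ⟩
    suc (w p)    ∎
    where open ≡-Reasoning

  shift-target : w q ≡ suc (u q)
  shift-target = begin
    w q          ≡⟨ +δ-≢ (w q) (λ q≡p → p≢q (sym q≡p)) ⟨
    w q + δ q p  ≡⟨ u→w q ⟩
    u q + δ q q  ≡⟨ +δ-refl (u q) q ⟩
    suc (u q)    ∎
    where open ≡-Reasoning

shift-other : {u w : Fin k → ℕ} {p q i : Fin k} → Shift u w p q → i ≢ p → i ≢ q → w i ≡ u i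
shift-other {u = u} {w} {p} {q} {i} u→w i≢p i≢q = begin
  w i          ≡⟨ +δ-≢ (w i) i≢p ⟨
  w i + δ i p  ≡⟨ u→w i ⟩
  u i + δ i q  ≡⟨ +δ-≢ (u i) i≢q ⟩
  u i          ∎
  where open ≡-Reasoning

module _ {u w : Fin k → ℕ} {p q x z : Fin k} (u→w : Shift₂ u w p q x z) where

  shift₂-source : p ≢ q → p ≢ x → p ≢ z → w p < u p
  shift₂-source p≢q p≢x p≢z = ℕ.≤-reflexive (begin
    suc (w p)                  ≡⟨ +δ-refl (w p) p ⟨
    w p + δ p p                ≡⟨ +δ-≢ (w p + δ p p) p≢q ⟨
    w p + δ p p + δ p q        ≡⟨ u→w p ⟩
    u p + δ p x + δ p z        ≡⟨ +δ-≢ (u p + δ p x) p≢z ⟩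
    u p + δ p x                ≡⟨ +δ-≢ (u p) p≢x ⟩
    u p                        ∎)
    where open ≡-Reasoning

  shift₂-target : x ≢ p → x ≢ q → x ≢ z → w x ≡ suc (u x)
  shift₂-target x≢p x≢q x≢z = begin
    w x                        ≡⟨ +δ-≢ (w x) x≢p ⟨
    w x + δ x p                ≡⟨ +δ-≢ (w x + δ x p) x≢q ⟨
    w x + δ x p + δ x q        ≡⟨ u→w x ⟩
    u x + δ x x + δ x z        ≡⟨ +δ-≢ (u x + δ x x) x≢z ⟩
    u x + δ x x                ≡⟨ +δ-refl (u x) x ⟩
    suc (u x)                  ∎
    where open ≡-Reasoning

  shift₂-swap-sources : Shift₂ u w q p x z
  shift₂-swap-sources i = trans (xy∙z≈xz∙y (w i) (δ i q) (δ i p)) (u→w i)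

  shift₂-swap-targets : Shift₂ u w p q z x
  shift₂-swap-targets i = trans (u→w i) (xy∙z≈xz∙y (u i) (δ i x) (δ i z))

module _ {u m w : Fin k → ℕ} {p q x z : Fin k} where
  open ≡-Reasoning

  shift-∘ : Shift u m p x → Shift m w q z → Shift₂ u w p q x z
  shift-∘ u→m m→w i = begin
    w i + δ i p + δ i q  ≡⟨ xy∙z≈xz∙y (w i) (δ i p) (δ i q) ⟩
    w i + δ i q + δ i p  ≡⟨ cong (_+ δ i p) (m→w i) ⟩
    m i + δ i z + δ i p  ≡⟨ xy∙z≈xz∙y (m i) (δ i z) (δ i p) ⟩
    m i + δ i p + δ i z  ≡⟨ cong (_+ δ i z) (u→m i) ⟩
    u i + δ i x + δ i z  ∎

  shift₂-after : Shift₂ u w p q x z → Shift u m q x → Shift m w p z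
  shift₂-after u→w u→m i = ℕ.+-cancelʳ-≡ (δ i q) _ _ (begin
    w i + δ i p + δ i q  ≡⟨ u→w i ⟩
    u i + δ i x + δ i z  ≡⟨ cong (_+ δ i z) (u→m i) ⟨
    m i + δ i q + δ i z  ≡⟨ xy∙z≈xz∙y (m i) (δ i q) (δ i z) ⟩
    m i + δ i z + δ i q  ∎)

module _ {u w w' : Fin k → ℕ} where
  open ≡-Reasoning

  shift₂-sources : ∀ {p q q' x z} → Shift₂ u w p q x z → Shift₂ u w' p q' x z → Shift w w' q' q
  shift₂-sources {p} {q} {q'} {x} {z} u→w u→w' i = ℕ.+-cancelʳ-≡ (δ i p) _ _ (begin
    w' i + δ i q' + δ i p  ≡⟨ xy∙z≈xz∙y (w' i) (δ i q') (δ i p) ⟩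
    w' i + δ i p + δ i q'  ≡⟨ u→w' i ⟩
    u i + δ i x + δ i z    ≡⟨ u→w i ⟨
    w i + δ i p + δ i q    ≡⟨ xy∙z≈xz∙y (w i) (δ i p) (δ i q) ⟩
    w i + δ i q + δ i p    ∎)

  shift₂-targets : ∀ {p q x x' z} → Shift₂ u w p q x z → Shift₂ u w' p q x' z → Shift w w' x x'
  shift₂-targets {p} {q} {x} {x'} {z} u→w u→w' i = ℕ.+-cancelʳ-≡ (δ i p + δ i q) _ _ (begin
    w' i + δ i x + (δ i p + δ i q)  ≡⟨ move-last (w' i) (δ i x) (δ i p) (δ i q) ⟩
    w' i + δ i p + δ i q + δ i x    ≡⟨ cong (_+ δ i x) (u→w' i) ⟩
    u i + δ i x' + δ i z + δ i x    ≡⟨ swap-ends (u i) (δ i x') (δ i z) (δ i x) ⟩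
    u i + δ i x + δ i z + δ i x'    ≡⟨ cong (_+ δ i x') (u→w i) ⟨
    w i + δ i p + δ i q + δ i x'    ≡⟨ move-last (w i) (δ i x') (δ i p) (δ i q) ⟨
    w i + δ i x' + (δ i p + δ i q)  ∎)
    where
    open +-*-Solver
    move-last : ∀ a b c d → a + b + (c + d) ≡ a + c + d + b
    move-last = solve 4 (λ a b c d → a :+ b :+ (c :+ d) := a :+ c :+ d :+ b) refl
    swap-ends : ∀ a b c d → a + b + c + d ≡ a + d + c + b
    swap-ends = solve 4 (λ a b c d → a :+ b :+ c :+ d := a :+ d :+ c :+ b) refl

Σᶠ-cong : {g h : Fin k → ℕ} → (∀ i → g i ≡ h i) → Σᶠ g ≡ Σᶠ h
Σᶠ-cong {zero}  g≗h = refl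
Σᶠ-cong {suc k} g≗h = cong₂ _+_ (g≗h zero) (Σᶠ-cong (λ i → g≗h (suc i)))

Σᶠ-+ : (g h : Fin k → ℕ) → Σᶠ (λ i → g i + h i) ≡ Σᶠ g + Σᶠ h
Σᶠ-+ {zero}  g h = refl
Σᶠ-+ {suc k} g h = trans (cong (g zero + h zero +_) (Σᶠ-+ (λ i → g (suc i)) (λ i → h (suc i))))
                         (interchange (g zero) (h zero) _ _)

Σᶠ-zero : {g : Fin k → ℕ} → (∀ i → g i ≡ 0) → Σᶠ g ≡ 0
Σᶠ-zero {zero}  g≗0 = refl
Σᶠ-zero {suc k} g≗0 = cong₂ _+_ (g≗0 zero) (Σᶠ-zero (λ i → g≗0 (suc i)))

δ-suc : (i j : Fin k) → δ (suc i) (suc j) ≡ δ i j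
δ-suc i j = by-cases (i ≟ j)
  where
  by-cases : Dec (i ≡ j) → δ (suc i) (suc j) ≡ δ i j
  by-cases (yes refl) = trans (δ-refl (suc i)) (sym (δ-refl i))
  by-cases (no i≢j)   = trans (δ-≢ (λ e → i≢j (suc-injective e))) (sym (δ-≢ i≢j))

Σᶠ-δ : (j : Fin k) → Σᶠ (λ i → δ i j) ≡ 1
Σᶠ-δ {suc k} zero    = cong₂ _+_ (δ-refl {suc k} zero) (Σᶠ-zero {k} (λ i → δ-≢ {i = suc i} {j = zero} λ ()))
Σᶠ-δ {suc k} (suc j) = cong₂ _+_ (δ-≢ {i = zero} {j = suc j} λ ()) (trans (Σᶠ-cong (λ i → δ-suc i j)) (Σᶠ-δ j))

Σᶠ-shift : {u w : Fin k → ℕ} {p q : Fin k} → Shift u w p q → Σᶠ w ≡ Σᶠ u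
Σᶠ-shift {u = u} {w} {p} {q} u→w = ℕ.+-cancelʳ-≡ 1 _ _ (begin
  Σᶠ w + 1                       ≡⟨ cong (Σᶠ w +_) (Σᶠ-δ p) ⟨
  Σᶠ w + Σᶠ (λ i → δ i p)        ≡⟨ Σᶠ-+ w (λ i → δ i p) ⟨
  Σᶠ (λ i → w i + δ i p)         ≡⟨ Σᶠ-cong u→w ⟩
  Σᶠ (λ i → u i + δ i q)         ≡⟨ Σᶠ-+ u (λ i → δ i q) ⟩
  Σᶠ u + Σᶠ (λ i → δ i q)        ≡⟨ cong (Σᶠ u +_) (Σᶠ-δ q) ⟩
  Σᶠ u + 1                       ∎)
  where open ≡-Reasoning

∣suc-m-m∣≡1 : ∀ m → ∣ suc m - m ∣ ≡ 1
∣suc-m-m∣≡1 zero    = refl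
∣suc-m-m∣≡1 (suc m) = ∣suc-m-m∣≡1 m

shift-dist : {u w : Fin k → ℕ} {p q : Fin k} → p ≢ q → Shift u w p q →
             Σᶠ (λ i → ∣ u i - w i ∣) ≡ 2
shift-dist {u = u} {w} {p} {q} p≢q u→w =
  trans (Σᶠ-cong (λ i → pointwise (i ≟ p) (i ≟ q))) (trans (Σᶠ-+ (λ i → δ i p) (λ i → δ i q)) (cong₂ _+_ (Σᶠ-δ p) (Σᶠ-δ q)))
  where
  open ≡-Reasoning
  pointwise : ∀ {i} → Dec (i ≡ p) → Dec (i ≡ q) → ∣ u i - w i ∣ ≡ δ i p + δ i q
  pointwise (yes refl) (yes refl) = contradiction refl p≢q
  pointwise {i} (yes refl) (no i≢q) = begin
    ∣ u i - w i ∣       ≡⟨ cong ∣_- w i ∣ (shift-source p≢q u→w) ⟩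
    ∣ suc (w i) - w i ∣ ≡⟨ ∣suc-m-m∣≡1 (w i) ⟩
    1                   ≡⟨ cong₂ _+_ (δ-refl i) (δ-≢ i≢q) ⟨
    δ i i + δ i q       ∎
  pointwise {i} (no i≢p) (yes refl) = begin
    ∣ u i - w i ∣       ≡⟨ cong (∣ u i -_∣) (shift-target p≢q u→w) ⟩
    ∣ u i - suc (u i) ∣ ≡⟨ ℕ.∣-∣-comm (u i) (suc (u i)) ⟩
    ∣ suc (u i) - u i ∣ ≡⟨ ∣suc-m-m∣≡1 (u i) ⟩
    1                   ≡⟨ cong₂ _+_ (δ-≢ i≢p) (δ-refl i) ⟨
    δ i p + δ i i       ∎
  pointwise {i} (no i≢p) (no i≢q) = begin
    ∣ u i - w i ∣       ≡⟨ cong (∣ u i -_∣) (shift-other u→w i≢p i≢q) ⟩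
    ∣ u i - u i ∣       ≡⟨ ℕ.∣n-n∣≡0 (u i) ⟩
    0                   ≡⟨ cong₂ _+_ (δ-≢ i≢p) (δ-≢ i≢q) ⟨
    δ i p + δ i q       ∎

shifted-at : {A B : Set} → Dec A → Dec B → ℕ → ℕ
shifted-at (yes _) _       m = suc m
shifted-at (no _)  (yes _) m = m ∸ 1
shifted-at (no _)  (no _)  m = m

shifted : (Fin k → ℕ) → Fin k → Fin k → Fin k → ℕ
shifted u p q i = shifted-at (i ≟ q) (i ≟ p) (u i)

shifted-Shift : {u : Fin k → ℕ} {p q : Fin k} → p ≢ q → 0 < u p → Shift u (shifted u p q) p q
shifted-Shift {u = u} {p} {q} p≢q pos i = pointwise (i ≟ q) (i ≟ p)
  where
  pointwise : ∀ {i} (d : Dec (i ≡ q)) (e : Dec (i ≡ p)) → shifted-at d e (u i) + δ i p ≡ u i + δ i q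
  pointwise (yes refl) (yes refl) = contradiction refl p≢q
  pointwise {i} (yes refl) (no i≢p) = trans (+δ-≢ (suc (u i)) i≢p) (sym (+δ-refl (u i) i))
  pointwise {i} (no i≢q) (yes refl) = trans (+δ-refl (u i ∸ 1) i)
    (trans (ℕ.suc-pred (u i) {{>-nonZero pos}}) (sym (+δ-≢ (u i) i≢q)))
  pointwise {i} (no i≢q) (no i≢p) = trans (+δ-≢ (u i) i≢p) (sym (+δ-≢ (u i) i≢q))

shift-exists : (u : DemandVec n k) {p q : Fin k} → p ≢ q → 0 < proj₁ u p →
               Σ (DemandVec n k) λ w → Shift (proj₁ u) (proj₁ w) p q
shift-exists (u , Σu≡n) {p} {q} p≢q pos = (shifted u p q , trans (Σᶠ-shift u→w) Σu≡n) , u→w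
  where
  u→w : Shift u (shifted u p q) p q
  u→w = shifted-Shift p≢q pos

Shift⇒MovesUnit : (u w : DemandVec n k) {p q : Fin k} → p ≢ q → Shift (proj₁ u) (proj₁ w) p q →
                  MovesUnit u p q w
Shift⇒MovesUnit (u , _) (w , _) p≢q u→w =
  sym (cong (_∸ 1) (shift-source p≢q u→w)) , shift-target p≢q u→w , λ i → shift-other u→w

-- Reassignments of agents

≡⇒≢ : {X : Set} {a b c : X} → a ≡ c → b ≢ c → a ≢ b
≡⇒≢ a≡c b≢c a≡b = b≢c (trans (sym a≡b) a≡c)

-- switchCost f v w and load f v are disagreements (F v) (F w) and loads (F v) by definition,
-- where F u a = f a u.
disagreements : (g h : Fin n → Fin k) → ℕ
disagreements g h = count (λ a → ¬? (g a ≟ h a))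

loads : (Fin n → Fin k) → Fin k → ℕ
loads g j = count (λ a → g a ≟ j)

module _ {g h : Fin n → Fin k} where

  ¬three-disagreements : disagreements g h ≤ 2 → {a b c : Fin n} → a ≢ b → a ≢ c → b ≢ c →
                         g a ≢ h a → g b ≢ h b → g c ≢ h c → ⊥
  ¬three-disagreements ≤2 a≢b a≢c b≢c ga≢ha gb≢hb gc≢hc = ℕ.<⇒≱
    (count-≥-length (λ a → ¬? (g a ≟ h a)) (_ ∷ _ ∷ _ ∷ [])
      ((a≢b ∷ a≢c ∷ []) ∷ (b≢c ∷ []) ∷ [] ∷ []) (ga≢ha ∷ gb≢hb ∷ gc≢hc ∷ []))
    ≤2

  agree-off-two : disagreements g h ≤ 2 → {a b : Fin n} → a ≢ b → g a ≢ h a → g b ≢ h b →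
                  ∀ y → y ≢ a → y ≢ b → g y ≡ h y
  agree-off-two ≤2 a≢b ga≢ha gb≢hb y y≢a y≢b with g y ≟ h y
  ... | yes gy≡hy = gy≡hy
  ... | no gy≢hy  = ⊥-elim (¬three-disagreements ≤2 a≢b (≢-sym y≢a) (≢-sym y≢b) ga≢ha gb≢hb gy≢hy)

  agree-off-one : disagreements g h ≤ 1 → {a : Fin n} → g a ≢ h a → ∀ y → y ≢ a → g y ≡ h y
  agree-off-one ≤1 ga≢ha y y≢a with g y ≟ h y
  ... | yes gy≡hy = gy≡hy
  ... | no gy≢hy  = ⊥-elim (ℕ.<⇒≱
    (count-≥-length (λ a → ¬? (g a ≟ h a)) (_ ∷ _ ∷ []) ((≢-sym y≢a ∷ []) ∷ [] ∷ []) (ga≢ha ∷ gy≢hy ∷ []))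
    ≤1)

only-mover : {A B : Fin n → Fin k} {α : Fin n} → (∀ a → a ≢ α → B a ≡ A a) →
             ∀ {a} → B a ≢ A a → a ≡ α
only-mover {α = α} fixed {a} Ba≢Aa with a ≟ α
... | yes a≡α = a≡α
... | no a≢α  = contradiction (fixed a a≢α) Ba≢Aa

only-movers : {A B : Fin n → Fin k} {α β : Fin n} → (∀ a → a ≢ α → a ≢ β → B a ≡ A a) →
              ∀ {a} → B a ≢ A a → a ≡ α ⊎ a ≡ β
only-movers {α = α} {β} fixed {a} Ba≢Aa with a ≟ α | a ≟ β
... | yes a≡α | _       = inj₁ a≡α
... | no _    | yes a≡β = inj₂ a≡β
... | no a≢α  | no a≢β  = contradiction (fixed a a≢α a≢β) Ba≢Aa

record Reassigns (A B : Fin n → Fin k) (α : Fin n) (y : Fin k) : Set where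
  field
    moved : B α ≡ y
    fixed : ∀ a → a ≢ α → B a ≡ A a

unique-mover : {A B : Fin n → Fin k} {s t : Fin k} → disagreements A B ≡ 1 → s ≢ t →
               Shift (loads A) (loads B) s t → Σ (Fin n) λ α → A α ≡ s × Reassigns A B α t
unique-mover {A = A} {B} {s} {t} ≡1 s≢t A→B = α , Aα≡s , record { moved = Bα≡t ; fixed = fixed }
  where
  disagreement = count-pos⇒∃ (λ a → ¬? (A a ≟ B a)) (subst (0 <_) (sym ≡1) (s≤s z≤n))
  α = proj₁ disagreement
  fixed : ∀ a → a ≢ α → B a ≡ A a
  fixed a a≢α = sym (agree-off-one (ℕ.≤-reflexive ≡1) (proj₂ disagreement) a a≢α)
  Bα≡t : B α ≡ t
  Bα≡t with count-<⇒∃ (λ a → A a ≟ t) (λ a → B a ≟ t) (ℕ.≤-reflexive (sym (shift-target s≢t A→B)))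
  ... | a , Ba≡t , Aa≢t with only-mover fixed {a} (λ Ba≡Aa → Aa≢t (trans (sym Ba≡Aa) Ba≡t))
  ...   | refl = Ba≡t
  Aα≡s : A α ≡ s
  Aα≡s with count-<⇒∃ (λ a → B a ≟ s) (λ a → A a ≟ s) (ℕ.≤-reflexive (sym (shift-source s≢t A→B)))
  ... | a , Aa≡s , Ba≢s with only-mover fixed {a} (λ Ba≡Aa → Ba≢s (trans Ba≡Aa Aa≡s))
  ...   | refl = Aa≡s

-- Q arises from A by moving α and β to x, after which one agent ζ (α, β or an agent already at x)
-- moves on to z.
record DoubleMove (A Q : Fin n → Fin k) (α β : Fin n) (x z : Fin k) : Set where
  field
    ζ           : Fin n
    ζ-at-z      : Q ζ ≡ z
    ζ-origin    : ζ ≡ α ⊎ ζ ≡ β ⊎ A ζ ≡ x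
    movers-at-x : ∀ a → a ≢ ζ → a ≡ α ⊎ a ≡ β → Q a ≡ x
    others-fixed : ∀ a → a ≢ α → a ≢ β → a ≢ ζ → Q a ≡ A a

module _ {A Q : Fin n → Fin k} {α β : Fin n} {x z : Fin k} (D : DoubleMove A Q α β x z) where
  open DoubleMove D

  DoubleMove-swap : DoubleMove A Q β α x z
  DoubleMove-swap = record
    { ζ = ζ
    ; ζ-at-z = ζ-at-z
    ; ζ-origin = [ inj₂ ∘ inj₁ , [ inj₁ , inj₂ ∘ inj₂ ] ] ζ-origin
    ; movers-at-x = λ a a≢ζ a∈ → movers-at-x a a≢ζ (Sum.swap a∈)
    ; others-fixed = λ a a≢β a≢α → others-fixed a a≢α a≢β
    }

  ζ-≢ : ∀ {a} → a ≢ α → a ≢ β → A a ≢ x → ζ ≢ a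
  ζ-≢ a≢α a≢β Aa≢x refl with ζ-origin
  ... | inj₁ a≡α        = a≢α a≡α
  ... | inj₂ (inj₁ a≡β) = a≢β a≡β
  ... | inj₂ (inj₂ Aa≡x) = Aa≢x Aa≡x

  ζ-from-x : ¬ (ζ ≡ α ⊎ ζ ≡ β) → A ζ ≡ x
  ζ-from-x ζ∉αβ with ζ-origin
  ... | inj₁ ζ≡α         = contradiction (inj₁ ζ≡α) ζ∉αβ
  ... | inj₂ (inj₁ ζ≡β)  = contradiction (inj₂ ζ≡β) ζ∉αβ
  ... | inj₂ (inj₂ Aζ≡x) = Aζ≡x

  mover-moved : ∀ {a} → a ≡ α ⊎ a ≡ β → A a ≢ x → A a ≢ z → Q a ≢ A a
  mover-moved {a} a∈ Aa≢x Aa≢z with a ≟ ζ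
  ... | yes refl = ≡⇒≢ ζ-at-z Aa≢z
  ... | no a≢ζ   = ≡⇒≢ (movers-at-x a a≢ζ a∈) Aa≢x

  off-ζ : ∀ {a} → a ≢ ζ → Q a ≡ x ⊎ Q a ≡ A a
  off-ζ {a} a≢ζ with a ≟ α | a ≟ β
  ... | yes a≡α | _       = inj₁ (movers-at-x a a≢ζ (inj₁ a≡α))
  ... | no _    | yes a≡β = inj₁ (movers-at-x a a≢ζ (inj₂ a≡β))
  ... | no a≢α  | no a≢β  = inj₂ (others-fixed a a≢α a≢β a≢ζ)

  DoubleMove-avoids : ∀ {a c} → A a ≢ c → x ≢ c → z ≢ c → Q a ≢ c
  DoubleMove-avoids {a} Aa≢c x≢c z≢c with a ≟ ζ
  ... | yes refl = ≡⇒≢ ζ-at-z (≢-sym z≢c)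
  ... | no a≢ζ with off-ζ a≢ζ
  ...   | inj₁ Qa≡x  = ≡⇒≢ Qa≡x (≢-sym x≢c)
  ...   | inj₂ Qa≡Aa = ≡⇒≢ Qa≡Aa (≢-sym Aa≢c)

  ζ-unique : x ≢ z → ∀ {a} → Q a ≡ z → A a ≢ z → a ≡ ζ
  ζ-unique x≢z {a} Qa≡z Aa≢z with a ≟ ζ
  ... | yes a≡ζ = a≡ζ
  ... | no a≢ζ with off-ζ a≢ζ
  ...   | inj₁ Qa≡x  = contradiction (trans (sym Qa≡x) Qa≡z) x≢z
  ...   | inj₂ Qa≡Aa = contradiction (trans (sym Qa≡Aa) Qa≡z) Aa≢z

module Classification
  {A Q Aα Aβ : Fin n → Fin k} {α β : Fin n} {x z p q : Fin k}
  (x≢z : x ≢ z) (x≢p : x ≢ p) (x≢q : x ≢ q) (z≢p : z ≢ p) (z≢q : z ≢ q) (p≢q : p ≢ q)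
  (Aα≡p : A α ≡ p) (Aβ≡q : A β ≡ q) (α↦x : Reassigns A Aα α x) (β↦x : Reassigns A Aβ β x)
  (Aα≈Q : disagreements Aα Q ≤ 2) (Aβ≈Q : disagreements Aβ Q ≤ 2)
  (A→Q : Shift₂ (loads A) (loads Q) p q x z)
  where

  α≢β : α ≢ β
  α≢β refl = p≢q (trans (sym Aα≡p) Aβ≡q)

  leaving : ∀ {c} → loads Q c < loads A c → ∃ λ a → A a ≡ c × Q a ≢ c
  leaving {c} = count-<⇒∃ (λ a → Q a ≟ c) (λ a → A a ≟ c)

  arriving : ∀ {c} → loads A c < loads Q c → ∃ λ a → Q a ≡ c × A a ≢ c
  arriving {c} = count-<⇒∃ (λ a → A a ≟ c) (λ a → Q a ≟ c)

  x-gain : loads Q x ≡ suc (loads A x)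
  x-gain = shift₂-target A→Q x≢p x≢q x≢z

  z-gain : loads Q z ≡ suc (loads A z)
  z-gain = shift₂-target (shift₂-swap-targets A→Q) z≢p z≢q (≢-sym x≢z)

  q-vacated : Q β ≢ q
  q-vacated Qβ≡q with leaving (shift₂-source A→Q p≢q (≢-sym x≢p) (≢-sym z≢p))
                    | leaving (shift₂-source (shift₂-swap-sources A→Q) (≢-sym p≢q) (≢-sym x≢q) (≢-sym z≢q))
  ... | wp , Awp≡p , Qwp≢p | wq , Awq≡q , Qwq≢q =
    ¬three-disagreements Aβ≈Q β≢wp β≢wq wp≢wq
      (≡⇒≢ moved (λ Qβ≡x → x≢q (trans (sym Qβ≡x) Qβ≡q)))
      (≡⇒≢ (trans (fixed wp (≢-sym β≢wp)) Awp≡p) Qwp≢p)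
      (≡⇒≢ (trans (fixed wq (≢-sym β≢wq)) Awq≡q) Qwq≢q)
    where
    open Reassigns β↦x
    β≢wp : β ≢ wp
    β≢wp refl = p≢q (trans (sym Awp≡p) Aβ≡q)
    β≢wq : β ≢ wq
    β≢wq refl = Qwq≢q Qβ≡q
    wp≢wq : wp ≢ wq
    wp≢wq refl = p≢q (trans (sym Awp≡p) Awq≡q)

  α-diverted : Q α ≢ x → DoubleMove A Q α β x z
  α-diverted Qα≢x = record
    { ζ = α ; ζ-at-z = Qα≡z ; ζ-origin = inj₁ refl
    ; movers-at-x = movers-at-x ; others-fixed = λ a a≢α a≢β _ → fixed a a≢α a≢β }
    where
    open Reassigns α↦x renaming (fixed to α-only)
    fixed : ∀ a → a ≢ α → a ≢ β → Q a ≡ A a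
    fixed a a≢α a≢β = trans (sym (agree-off-two Aα≈Q α≢β
        (≡⇒≢ moved Qα≢x) (≡⇒≢ (trans (α-only β (≢-sym α≢β)) Aβ≡q) q-vacated) a a≢α a≢β))
      (α-only a a≢α)
    Qβ≡x : Q β ≡ x
    Qβ≡x with arriving (ℕ.≤-reflexive (sym x-gain))
    ... | a , Qa≡x , Aa≢x with only-movers fixed (≡⇒≢ Qa≡x Aa≢x)
    ...   | inj₁ refl = contradiction Qa≡x Qα≢x
    ...   | inj₂ refl = Qa≡x
    Qα≡z : Q α ≡ z
    Qα≡z with arriving (ℕ.≤-reflexive (sym z-gain))
    ... | a , Qa≡z , Aa≢z with only-movers fixed (≡⇒≢ Qa≡z Aa≢z)
    ...   | inj₁ refl = Qa≡z
    ...   | inj₂ refl = contradiction (trans (sym Qβ≡x) Qa≡z) x≢z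
    movers-at-x : ∀ a → a ≢ α → a ≡ α ⊎ a ≡ β → Q a ≡ x
    movers-at-x a a≢α (inj₁ a≡α) = contradiction a≡α a≢α
    movers-at-x a _   (inj₂ refl) = Qβ≡x

  both-at-x : Q α ≡ x → Q β ≡ x → DoubleMove A Q α β x z
  both-at-x Qα≡x Qβ≡x with arriving (ℕ.≤-reflexive (sym z-gain))
  ... | w , Qw≡z , Aw≢z = record
    { ζ = w ; ζ-at-z = Qw≡z ; ζ-origin = inj₂ (inj₂ Aw≡x)
    ; movers-at-x = movers-at-x ; others-fixed = fixed }
    where
    open Reassigns α↦x renaming (fixed to α-only)
    w≢α : w ≢ α
    w≢α refl = x≢z (trans (sym Qα≡x) Qw≡z)
    w≢β : w ≢ β
    w≢β refl = x≢z (trans (sym Qβ≡x) Qw≡z)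
    fixed : ∀ a → a ≢ α → a ≢ β → a ≢ w → Q a ≡ A a
    fixed a a≢α a≢β a≢w = trans (sym (agree-off-two Aα≈Q (≢-sym w≢β)
        (≡⇒≢ (trans (α-only β (≢-sym α≢β)) Aβ≡q) (λ Qβ≡q → x≢q (trans (sym Qβ≡x) Qβ≡q)))
        (≡⇒≢ (α-only w w≢α) (λ Qw≡Aw → Aw≢z (trans (sym Qw≡Aw) Qw≡z))) a a≢β a≢w))
      (α-only a a≢α)
    -- Q has only one agent more at x than A, yet α and β arrive there: someone left x, and only w can have.
    Aw≡x : A w ≡ x
    Aw≡x with count-≤suc⇒∃ (λ a → A a ≟ x) (λ a → Q a ≟ x) (ℕ.≤-reflexive x-gain) α≢β
                Qα≡x (λ Aα≡x → x≢p (trans (sym Aα≡x) Aα≡p)) Qβ≡x (λ Aβ≡x → x≢q (trans (sym Aβ≡x) Aβ≡q))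
    ... | a , Aa≡x , Qa≢x with a ≟ w
    ...   | yes refl = Aa≡x
    ...   | no a≢w   = contradiction (trans (fixed a a≢α a≢β a≢w) Aa≡x) Qa≢x
      where
      a≢α : a ≢ α
      a≢α refl = x≢p (trans (sym Aa≡x) Aα≡p)
      a≢β : a ≢ β
      a≢β refl = x≢q (trans (sym Aa≡x) Aβ≡q)
    movers-at-x : ∀ a → a ≢ w → a ≡ α ⊎ a ≡ β → Q a ≡ x
    movers-at-x a _ (inj₁ refl) = Qα≡x
    movers-at-x a _ (inj₂ refl) = Qβ≡x

module _
  {A Q Aα Aβ : Fin n → Fin k} {α β : Fin n} {x z p q : Fin k}
  (x≢z : x ≢ z) (x≢p : x ≢ p) (x≢q : x ≢ q) (z≢p : z ≢ p) (z≢q : z ≢ q) (p≢q : p ≢ q)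
  (Aα≡p : A α ≡ p) (Aβ≡q : A β ≡ q) (α↦x : Reassigns A Aα α x) (β↦x : Reassigns A Aβ β x)
  (Aα≈Q : disagreements Aα Q ≤ 2) (Aβ≈Q : disagreements Aβ Q ≤ 2)
  (A→Q : Shift₂ (loads A) (loads Q) p q x z)
  where

  private
    module Cases = Classification x≢z x≢p x≢q z≢p z≢q p≢q Aα≡p Aβ≡q α↦x β↦x Aα≈Q Aβ≈Q A→Q
    module Swapped = Classification x≢z x≢q x≢p z≢q z≢p (≢-sym p≢q) Aβ≡q Aα≡p β↦x α↦x Aβ≈Q Aα≈Q
                       (shift₂-swap-sources A→Q)

  classify : DoubleMove A Q α β x z
  classify with Q α ≟ x | Q β ≟ x
  ... | no Qα≢x  | _         = Cases.α-diverted Qα≢x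
  ... | yes _    | no Qβ≢x   = DoubleMove-swap (Swapped.α-diverted Qβ≢x)
  ... | yes Qα≡x | yes Qβ≡x  = Cases.both-at-x Qα≡x Qβ≡x

open DoubleMove using (ζ)

ζ-follows : {A Q Q' : Fin n → Fin k} {α β β' : Fin n} {x z : Fin k}
            (D : DoubleMove A Q α β x z) (D' : DoubleMove A Q' α β' x z) → x ≢ z →
            A α ≢ z → A β' ≢ x → α ≢ β' → β ≢ β' → (∀ a → a ≢ β → a ≢ β' → Q a ≡ Q' a) →
            ζ D ≢ β → ζ D ≡ ζ D'
ζ-follows {A = A} {β' = β'} {z = z} D D' x≢z Aα≢z Aβ'≢x α≢β' β≢β' agree ζ≢β =
  ζ-unique D' x≢z (trans (sym (agree (ζ D) ζ≢β ζ≢β')) (DoubleMove.ζ-at-z D)) Aζ≢z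
  where
  ζ≢β' : ζ D ≢ β'
  ζ≢β' = ζ-≢ D (≢-sym α≢β') (≢-sym β≢β') Aβ'≢x
  Aζ≢z : A (ζ D) ≢ z
  Aζ≢z with DoubleMove.ζ-origin D
  ... | inj₁ refl        = Aα≢z
  ... | inj₂ (inj₁ ζ≡β)  = contradiction ζ≡β ζ≢β
  ... | inj₂ (inj₂ Aζ≡x) = ≡⇒≢ Aζ≡x (≢-sym x≢z)

-- Q and Q' disagree at β and β', hence agree elsewhere, so they send the same agent to z
-- unless that agent is β, respectively β'.
ζ-agree : {A Q Q' : Fin n → Fin k} {α β β' : Fin n} {x z : Fin k}
          (D : DoubleMove A Q α β x z) (D' : DoubleMove A Q' α β' x z) → x ≢ z →
          disagreements Q Q' ≤ 2 → A α ≢ z → A β ≢ x → A β ≢ z → A β' ≢ x → A β' ≢ z →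
          α ≢ β → α ≢ β' → β ≢ β' → ζ D ≡ ζ D' ⊎ (ζ D ≡ β × ζ D' ≡ β')
ζ-agree {A = A} {Q} {Q'} {α} {β} {β'} D D' x≢z ≤2 Aα≢z Aβ≢x Aβ≢z Aβ'≢x Aβ'≢z α≢β α≢β' β≢β' =
  by-cases (ζ D ≟ β) (ζ D' ≟ β')
  where
  Q'β-fixed : Q' β ≡ A β
  Q'β-fixed = DoubleMove.others-fixed D' β (≢-sym α≢β) β≢β' (≢-sym (ζ-≢ D' (≢-sym α≢β) β≢β' Aβ≢x))
  Qβ'-fixed : Q β' ≡ A β'
  Qβ'-fixed = DoubleMove.others-fixed D β' (≢-sym α≢β') (≢-sym β≢β') (≢-sym (ζ-≢ D (≢-sym α≢β') (≢-sym β≢β') Aβ'≢x))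
  agree : ∀ a → a ≢ β → a ≢ β' → Q a ≡ Q' a
  agree = agree-off-two ≤2 β≢β'
    (λ Qβ≡Q'β → mover-moved D (inj₂ refl) Aβ≢x Aβ≢z (trans Qβ≡Q'β Q'β-fixed))
    (λ Qβ'≡Q'β' → mover-moved D' (inj₂ refl) Aβ'≢x Aβ'≢z (trans (sym Qβ'≡Q'β') Qβ'-fixed))
  by-cases : Dec (ζ D ≡ β) → Dec (ζ D' ≡ β') → ζ D ≡ ζ D' ⊎ (ζ D ≡ β × ζ D' ≡ β')
  by-cases (no ζ≢β)  _           = inj₁ (ζ-follows D D' x≢z Aα≢z Aβ'≢x α≢β' β≢β' agree ζ≢β)
  by-cases (yes _)   (no ζ'≢β')  = inj₁ (sym (ζ-follows D' D x≢z Aα≢z Aβ≢x α≢β (≢-sym β≢β')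
                                       (λ a a≢β' a≢β → sym (agree a a≢β a≢β')) ζ'≢β'))
  by-cases (yes ζ≡β) (yes ζ'≡β') = inj₂ (ζ≡β , ζ'≡β')

ζ-triangle : {a₁ a₂ a₃ ζ₃₁ ζ₃₂ ζ₁₂ : Fin n} → a₁ ≢ a₂ → a₁ ≢ a₃ → a₂ ≢ a₃ → ζ₃₂ ≢ a₁ → ζ₃₁ ≢ a₂ →
             ζ₃₁ ≡ ζ₃₂ ⊎ (ζ₃₁ ≡ a₁ × ζ₃₂ ≡ a₂) → ζ₃₁ ≡ ζ₁₂ ⊎ (ζ₃₁ ≡ a₃ × ζ₁₂ ≡ a₂) →
             ζ₃₂ ≡ ζ₁₂ ⊎ (ζ₃₂ ≡ a₃ × ζ₁₂ ≡ a₁) → ¬ (ζ₁₂ ≡ a₁ ⊎ ζ₁₂ ≡ a₂)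
ζ-triangle a₁≢a₂ _ _ _ _ _ (inj₂ (_ , ζ₁₂≡a₂)) _ (inj₁ ζ₁₂≡a₁) = a₁≢a₂ (trans (sym ζ₁₂≡a₁) ζ₁₂≡a₂)
ζ-triangle _ _ _ ζ₃₂≢a₁ _ (inj₁ ζ₃₁≡ζ₃₂) (inj₁ ζ₃₁≡ζ₁₂) _ (inj₁ ζ₁₂≡a₁) =
  ζ₃₂≢a₁ (trans (sym ζ₃₁≡ζ₃₂) (trans ζ₃₁≡ζ₁₂ ζ₁₂≡a₁))
ζ-triangle a₁≢a₂ _ _ _ _ (inj₂ (_ , ζ₃₂≡a₂)) (inj₁ _) (inj₁ ζ₃₂≡ζ₁₂) (inj₁ ζ₁₂≡a₁) =
  a₁≢a₂ (trans (sym ζ₁₂≡a₁) (trans (sym ζ₃₂≡ζ₁₂) ζ₃₂≡a₂))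
ζ-triangle _ _ a₂≢a₃ _ _ (inj₂ (_ , ζ₃₂≡a₂)) (inj₁ _) (inj₂ (ζ₃₂≡a₃ , _)) (inj₁ _) =
  a₂≢a₃ (trans (sym ζ₃₂≡a₂) ζ₃₂≡a₃)
ζ-triangle a₁≢a₂ _ _ _ _ _ _ (inj₂ (_ , ζ₁₂≡a₁)) (inj₂ ζ₁₂≡a₂) = a₁≢a₂ (trans (sym ζ₁₂≡a₁) ζ₁₂≡a₂)
ζ-triangle _ _ _ _ ζ₃₁≢a₂ _ (inj₁ ζ₃₁≡ζ₁₂) (inj₁ _) (inj₂ ζ₁₂≡a₂) = ζ₃₁≢a₂ (trans ζ₃₁≡ζ₁₂ ζ₁₂≡a₂)
ζ-triangle _ _ a₂≢a₃ _ _ (inj₁ ζ₃₁≡ζ₃₂) (inj₂ (ζ₃₁≡a₃ , _)) (inj₁ ζ₃₂≡ζ₁₂) (inj₂ ζ₁₂≡a₂) =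
  a₂≢a₃ (trans (sym ζ₁₂≡a₂) (trans (sym ζ₃₂≡ζ₁₂) (trans (sym ζ₃₁≡ζ₃₂) ζ₃₁≡a₃)))
ζ-triangle _ a₁≢a₃ _ _ _ (inj₂ (ζ₃₁≡a₁ , _)) (inj₂ (ζ₃₁≡a₃ , _)) (inj₁ _) (inj₂ _) =
  a₁≢a₃ (trans (sym ζ₃₁≡a₁) ζ₃₁≡a₃)

-- Units of demand are taken from s₁, s₂, s₃ and moved to the type-1 tasks T, T' or to z.
record Configuration (v : DemandVec n k) (T T' : Fin k) : Set where
  field
    s₁ s₂ s₃ z        : Fin k
    s₁>0              : 0 < proj₁ v s₁
    s₂>0              : 0 < proj₁ v s₂
    s₃>0              : 0 < proj₁ v s₃
    s₁≢s₂             : s₁ ≢ s₂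
    s₁≢s₃             : s₁ ≢ s₃
    s₂≢s₃             : s₂ ≢ s₃
    s₁≢T              : s₁ ≢ T
    s₂≢T              : s₂ ≢ T
    s₃≢T              : s₃ ≢ T
    s₁≢T'             : s₁ ≢ T'
    s₂≢T'             : s₂ ≢ T'
    z≢T               : z ≢ T
    z≢T'              : z ≢ T'
    z≢s₁              : z ≢ s₁
    z≢s₂              : z ≢ s₂
    z≢s₃              : z ≢ s₃
    T≢T'              : T ≢ T'

module Contradiction {f : Allocation n k} (valid : Valid f) (maxsc : MaxSwitchCostAtMost f 2)
  {v : DemandVec n k} {T T' : Fin k} (c : Configuration v T T')
  (T-type1 : Type1 f v T) (T'-type1 : Type1 f v T') where

  open Configuration c

  A : Fin n → Fin k
  A a = f a v

  F : DemandVec n k → Fin n → Fin k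
  F w a = f a w

  loads-Shift : {u w : DemandVec n k} {p q : Fin k} → Shift (proj₁ u) (proj₁ w) p q →
                Shift (loads (F u)) (loads (F w)) p q
  loads-Shift {u} {w} {p} {q} u→w i =
    trans (cong (_+ δ i p) (valid w i)) (trans (u→w i) (cong (_+ δ i q) (sym (valid u i))))

  loads-Shift₂ : {u w : DemandVec n k} {p q x z : Fin k} → Shift₂ (proj₁ u) (proj₁ w) p q x z →
                 Shift₂ (loads (F u)) (loads (F w)) p q x z
  loads-Shift₂ {u} {w} {p} {q} {x} {z} u→w i =
    trans (cong (λ m → m + δ i p + δ i q) (valid w i))
          (trans (u→w i) (cong (λ m → m + δ i x + δ i z) (sym (valid u i))))

  neighbours : {u w : DemandVec n k} {p q : Fin k} → p ≢ q → Shift (proj₁ u) (proj₁ w) p q →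
               disagreements (F u) (F w) ≤ 2
  neighbours {u} {w} p≢q u→w = maxsc u w (shift-dist p≢q u→w)

  record FirstMove (s S : Fin k) : Set where
    field
      vec       : DemandVec n k
      shift     : Shift (proj₁ v) (proj₁ vec) s S
      agent     : Fin n
      from      : A agent ≡ s
      reassigns : Reassigns A (F vec) agent S

  first-move : {s S : Fin k} → Type1 f v S → s ≢ S → 0 < proj₁ v s → FirstMove s S
  first-move {s} {S} type1 s≢S s>0 with shift-exists v s≢S s>0
  ... | V , v→V with unique-mover (type1 s s≢S s>0 V (Shift⇒MovesUnit v V s≢S v→V)) s≢S (loads-Shift v→V)
  ...   | α , Aα≡s , α↦S = record { vec = V ; shift = v→V ; agent = α ; from = Aα≡s ; reassigns = α↦S }

  record SecondMove (p q x z : Fin k) (α β : Fin n) : Set where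
    field
      vec    : DemandVec n k
      shift₂ : Shift₂ (proj₁ v) (proj₁ vec) p q x z
      double : DoubleMove A (F vec) α β x z

  second-move : {p q x z : Fin k} (M : FirstMove p x) (M' : FirstMove q x) →
                x ≢ z → x ≢ p → x ≢ q → z ≢ p → z ≢ q → p ≢ q → 0 < proj₁ v q →
                SecondMove p q x z (FirstMove.agent M) (FirstMove.agent M')
  second-move {p} {q} {x} {z} M M' x≢z x≢p x≢q z≢p z≢q p≢q q>0 = record
    { vec = W
    ; shift₂ = v→W
    ; double = classify x≢z x≢p x≢q z≢p z≢q p≢q (FirstMove.from M) (FirstMove.from M')
                 (FirstMove.reassigns M) (FirstMove.reassigns M')
                 (neighbours (≢-sym z≢q) Vp→W) (neighbours (≢-sym z≢p) (shift₂-after v→W (FirstMove.shift M')))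
                 (loads-Shift₂ v→W)
    }
    where
    step : Σ (DemandVec n k) λ w → Shift (proj₁ (FirstMove.vec M)) (proj₁ w) q z
    step = shift-exists (FirstMove.vec M) (≢-sym z≢q)
             (subst (0 <_) (sym (shift-other (FirstMove.shift M) (≢-sym p≢q) (≢-sym x≢q))) q>0)
    W : DemandVec n k
    W = proj₁ step
    Vp→W : Shift (proj₁ (FirstMove.vec M)) (proj₁ W) q z
    Vp→W = proj₂ step
    v→W : Shift₂ (proj₁ v) (proj₁ W) p q x z
    v→W = shift-∘ (FirstMove.shift M) Vp→W

  from-≢ : ∀ {a s c} → A a ≡ s → s ≢ c → A a ≢ c
  from-≢ Aa≡s s≢c Aa≡c = s≢c (trans (sym Aa≡s) Aa≡c)

  agents-≢ : ∀ {a b s s'} → A a ≡ s → A b ≡ s' → s ≢ s' → a ≢ b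
  agents-≢ Aa≡s Ab≡s' s≢s' refl = s≢s' (trans (sym Aa≡s) Ab≡s')

  m₁ : FirstMove s₁ T
  m₁ = first-move T-type1 s₁≢T s₁>0
  m₂ : FirstMove s₂ T
  m₂ = first-move T-type1 s₂≢T s₂>0
  m₃ : FirstMove s₃ T
  m₃ = first-move T-type1 s₃≢T s₃>0
  n₁ : FirstMove s₁ T'
  n₁ = first-move T'-type1 s₁≢T' s₁>0
  n₂ : FirstMove s₂ T'
  n₂ = first-move T'-type1 s₂≢T' s₂>0

  open FirstMove m₁ using () renaming (agent to a₁; from to Aa₁≡s₁)
  open FirstMove m₂ using () renaming (agent to a₂; from to Aa₂≡s₂)
  open FirstMove m₃ using () renaming (agent to a₃; from to Aa₃≡s₃)
  open FirstMove n₁ using () renaming (agent to b₁; from to Ab₁≡s₁)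
  open FirstMove n₂ using () renaming (agent to b₂; from to Ab₂≡s₂)

  M₃₁ : SecondMove s₃ s₁ T z a₃ a₁
  M₃₁ = second-move m₃ m₁ (≢-sym z≢T) (≢-sym s₃≢T) (≢-sym s₁≢T) z≢s₃ z≢s₁ (≢-sym s₁≢s₃) s₁>0
  M₃₂ : SecondMove s₃ s₂ T z a₃ a₂
  M₃₂ = second-move m₃ m₂ (≢-sym z≢T) (≢-sym s₃≢T) (≢-sym s₂≢T) z≢s₃ z≢s₂ (≢-sym s₂≢s₃) s₂>0
  M₁₂ : SecondMove s₁ s₂ T z a₁ a₂
  M₁₂ = second-move m₁ m₂ (≢-sym z≢T) (≢-sym s₁≢T) (≢-sym s₂≢T) z≢s₁ z≢s₂ s₁≢s₂ s₂>0
  Mᴿ : SecondMove s₁ s₂ T' z b₁ b₂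
  Mᴿ = second-move n₁ n₂ (≢-sym z≢T') (≢-sym s₁≢T') (≢-sym s₂≢T') z≢s₁ z≢s₂ s₁≢s₂ s₂>0

  open SecondMove M₃₁ using () renaming (shift₂ to v→Q₃₁; double to D₃₁)
  open SecondMove M₃₂ using () renaming (shift₂ to v→Q₃₂; double to D₃₂)
  open SecondMove M₁₂ using () renaming (vec to Q₁₂; shift₂ to v→Q₁₂; double to D₁₂)
  open SecondMove Mᴿ  using () renaming (vec to R; shift₂ to v→R; double to Dᴿ)

  T≢z : T ≢ z
  T≢z = ≢-sym z≢T
  a₁≢a₂ : a₁ ≢ a₂
  a₁≢a₂ = agents-≢ Aa₁≡s₁ Aa₂≡s₂ s₁≢s₂
  a₁≢a₃ : a₁ ≢ a₃
  a₁≢a₃ = agents-≢ Aa₁≡s₁ Aa₃≡s₃ s₁≢s₃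
  a₂≢a₃ : a₂ ≢ a₃
  a₂≢a₃ = agents-≢ Aa₂≡s₂ Aa₃≡s₃ s₂≢s₃

  P₁ : ζ D₃₁ ≡ ζ D₃₂ ⊎ (ζ D₃₁ ≡ a₁ × ζ D₃₂ ≡ a₂)
  P₁ = ζ-agree D₃₁ D₃₂ T≢z
    (neighbours (≢-sym s₁≢s₂) (shift₂-sources v→Q₃₁ v→Q₃₂))
    (from-≢ Aa₃≡s₃ (≢-sym z≢s₃)) (from-≢ Aa₁≡s₁ s₁≢T) (from-≢ Aa₁≡s₁ (≢-sym z≢s₁))
    (from-≢ Aa₂≡s₂ s₂≢T) (from-≢ Aa₂≡s₂ (≢-sym z≢s₂)) (≢-sym a₁≢a₃) (≢-sym a₂≢a₃) a₁≢a₂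

  P₂ : ζ D₃₁ ≡ ζ D₁₂ ⊎ (ζ D₃₁ ≡ a₃ × ζ D₁₂ ≡ a₂)
  P₂ = ζ-agree (DoubleMove-swap D₃₁) D₁₂ T≢z
    (neighbours s₂≢s₃ (shift₂-sources (shift₂-swap-sources v→Q₃₁) v→Q₁₂))
    (from-≢ Aa₁≡s₁ (≢-sym z≢s₁)) (from-≢ Aa₃≡s₃ s₃≢T) (from-≢ Aa₃≡s₃ (≢-sym z≢s₃))
    (from-≢ Aa₂≡s₂ s₂≢T) (from-≢ Aa₂≡s₂ (≢-sym z≢s₂)) a₁≢a₃ a₁≢a₂ (≢-sym a₂≢a₃)

  P₃ : ζ D₃₂ ≡ ζ D₁₂ ⊎ (ζ D₃₂ ≡ a₃ × ζ D₁₂ ≡ a₁)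
  P₃ = ζ-agree (DoubleMove-swap D₃₂) (DoubleMove-swap D₁₂) T≢z
    (neighbours s₁≢s₃ (shift₂-sources (shift₂-swap-sources v→Q₃₂) (shift₂-swap-sources v→Q₁₂)))
    (from-≢ Aa₂≡s₂ (≢-sym z≢s₂)) (from-≢ Aa₃≡s₃ s₃≢T) (from-≢ Aa₃≡s₃ (≢-sym z≢s₃))
    (from-≢ Aa₁≡s₁ s₁≢T) (from-≢ Aa₁≡s₁ (≢-sym z≢s₁)) a₂≢a₃ (≢-sym a₁≢a₂) (≢-sym a₁≢a₃)

  Aζ₁₂≡T : A (ζ D₁₂) ≡ T
  Aζ₁₂≡T = ζ-from-x D₁₂ (ζ-triangle a₁≢a₂ a₁≢a₃ a₂≢a₃
    (ζ-≢ D₃₂ a₁≢a₃ a₁≢a₂ (from-≢ Aa₁≡s₁ s₁≢T))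
    (ζ-≢ D₃₁ a₂≢a₃ (≢-sym a₁≢a₂) (from-≢ Aa₂≡s₂ s₂≢T)) P₁ P₂ P₃)

  -- R is the double move of Q₁₂ aimed at T' instead of T: the vectors are at distance 2, yet the
  -- allocations disagree at a₁, a₂ and ζ D₁₂.
  absurd : ⊥
  absurd = ¬three-disagreements (neighbours (≢-sym T≢T') (shift₂-targets v→R v→Q₁₂)) a₁≢a₂ a₁≢γ a₂≢γ
    (moved-off-T Aa₁≡s₁ s₁≢T (inj₁ refl)) (moved-off-T Aa₂≡s₂ s₂≢T (inj₂ refl))
    (λ Rγ≡Q₁₂γ → T≢z (trans (sym Rγ≡T) (trans Rγ≡Q₁₂γ (DoubleMove.ζ-at-z D₁₂))))
    where
    γ : Fin n
    γ = ζ D₁₂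
    a₁≢γ : a₁ ≢ γ
    a₁≢γ = agents-≢ Aa₁≡s₁ Aζ₁₂≡T s₁≢T
    a₂≢γ : a₂ ≢ γ
    a₂≢γ = agents-≢ Aa₂≡s₂ Aζ₁₂≡T s₂≢T
    moved-off-T : ∀ {a s} → A a ≡ s → s ≢ T → a ≡ a₁ ⊎ a ≡ a₂ → F R a ≢ F Q₁₂ a
    moved-off-T Aa≡s s≢T a∈ Ra≡Q₁₂a = DoubleMove-avoids Dᴿ (from-≢ Aa≡s s≢T) (≢-sym T≢T') z≢T
      (trans Ra≡Q₁₂a (DoubleMove.movers-at-x D₁₂ _ (agents-≢ Aa≡s Aζ₁₂≡T s≢T) a∈))
    γ≢b₁ : γ ≢ b₁
    γ≢b₁ = agents-≢ Aζ₁₂≡T Ab₁≡s₁ (≢-sym s₁≢T)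
    γ≢b₂ : γ ≢ b₂
    γ≢b₂ = agents-≢ Aζ₁₂≡T Ab₂≡s₂ (≢-sym s₂≢T)
    Rγ≡T : F R γ ≡ T
    Rγ≡T = trans (DoubleMove.others-fixed Dᴿ γ γ≢b₁ γ≢b₂
                   (≢-sym (ζ-≢ Dᴿ γ≢b₁ γ≢b₂ (from-≢ Aζ₁₂≡T T≢T'))))
                 Aζ₁₂≡T

positive-task : (v : DemandVec n k) → 4 ≤ nonZeroCount v → (xs : List (Fin k)) → length xs < 4 →
                ∃ λ s → 0 < proj₁ v s × s ∉ xs
positive-task v nz xs lt = fresh (λ i → 0 <? proj₁ v i) xs (ℕ.<-≤-trans lt nz)

spare-task : 5 ≤ k → (xs : List (Fin k)) → length xs < 5 → ∃ λ s → s ∉ xs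
spare-task k≥5 xs lt with fresh (λ _ → yes tt) xs (ℕ.<-≤-trans lt (subst (5 ≤_) (sym (count-all _ (λ _ → tt))) k≥5))
... | s , _ , s∉xs = s , s∉xs

configuration : {v : DemandVec n k} → 5 ≤ k → 4 ≤ nonZeroCount v → {t t' : Fin k} → t ≢ t' →
                Configuration v t t' ⊎ Configuration v t' t
configuration {k = k} {v} k≥5 nz {t} {t'} t≢t' = by-cases (0 <? proj₁ v t') (0 <? proj₁ v t)
  where
  s₁-pick : ∃ λ s → 0 < proj₁ v s × s ∉ t ∷ t' ∷ []
  s₁-pick = positive-task v nz _ (s≤s (s≤s (s≤s z≤n)))
  s₁ : Fin k
  s₁ = proj₁ s₁-pick
  s₁∉ : s₁ ∉ t ∷ t' ∷ []
  s₁∉ = proj₂ (proj₂ s₁-pick)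

  s₂-pick : ∃ λ s → 0 < proj₁ v s × s ∉ t ∷ t' ∷ s₁ ∷ []
  s₂-pick = positive-task v nz _ (s≤s (s≤s (s≤s (s≤s z≤n))))
  s₂ : Fin k
  s₂ = proj₁ s₂-pick
  s₂∉ : s₂ ∉ t ∷ t' ∷ s₁ ∷ []
  s₂∉ = proj₂ (proj₂ s₂-pick)

  z-pick : ∃ λ z → z ∉ t ∷ t' ∷ s₁ ∷ s₂ ∷ []
  z-pick = spare-task k≥5 _ ℕ.≤-refl
  z : Fin k
  z = proj₁ z-pick
  z∉ : z ∉ t ∷ t' ∷ s₁ ∷ s₂ ∷ []
  z∉ = proj₂ z-pick

  with-target : {T T' : Fin k} → T ≢ T' → 0 < proj₁ v T' → s₁ ≢ T → s₁ ≢ T' → s₂ ≢ T → s₂ ≢ T' →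
                z ≢ T → z ≢ T' → Configuration v T T'
  with-target T≢T' T'>0 s₁≢T s₁≢T' s₂≢T s₂≢T' z≢T z≢T' = record
    { s₁ = s₁ ; s₂ = s₂ ; s₃ = _ ; z = z
    ; s₁>0 = proj₁ (proj₂ s₁-pick) ; s₂>0 = proj₁ (proj₂ s₂-pick) ; s₃>0 = T'>0
    ; s₁≢s₂ = λ s₁≡s₂ → s₂∉ (there (there (here (sym s₁≡s₂)))) ; s₁≢s₃ = s₁≢T' ; s₂≢s₃ = s₂≢T'
    ; s₁≢T = s₁≢T ; s₂≢T = s₂≢T ; s₃≢T = ≢-sym T≢T' ; s₁≢T' = s₁≢T' ; s₂≢T' = s₂≢T'
    ; z≢T = z≢T ; z≢T' = z≢T' ; z≢s₁ = z∉ ∘ there ∘ there ∘ here ; z≢s₂ = z∉ ∘ there ∘ there ∘ there ∘ here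
    ; z≢s₃ = z≢T' ; T≢T' = T≢T'
    }

  unpositive : ∀ {i j} → 0 < proj₁ v i → ¬ 0 < proj₁ v j → i ≢ j
  unpositive i>0 j≯0 refl = j≯0 i>0

  without-target : ¬ 0 < proj₁ v t' → ¬ 0 < proj₁ v t → Configuration v t t'
  without-target t'≯0 t≯0 = record
    { s₁ = s₁ ; s₂ = s₂ ; s₃ = s₃ ; z = w
    ; s₁>0 = proj₁ (proj₂ s₁-pick) ; s₂>0 = proj₁ (proj₂ s₂-pick) ; s₃>0 = s₃>0
    ; s₁≢s₂ = λ s₁≡s₂ → s₂∉ (there (there (here (sym s₁≡s₂))))
    ; s₁≢s₃ = λ s₁≡s₃ → s₃∉ (here (sym s₁≡s₃)) ; s₂≢s₃ = λ s₂≡s₃ → s₃∉ (there (here (sym s₂≡s₃)))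
    ; s₁≢T = s₁∉ ∘ here ; s₂≢T = s₂∉ ∘ here ; s₃≢T = unpositive s₃>0 t≯0
    ; s₁≢T' = s₁∉ ∘ there ∘ here ; s₂≢T' = s₂∉ ∘ there ∘ here
    ; z≢T = unpositive w>0 t≯0 ; z≢T' = unpositive w>0 t'≯0
    ; z≢s₁ = w∉ ∘ here ; z≢s₂ = w∉ ∘ there ∘ here ; z≢s₃ = w∉ ∘ there ∘ there ∘ here ; T≢T' = t≢t'
    }
    where
    s₃-pick : ∃ λ s → 0 < proj₁ v s × s ∉ s₁ ∷ s₂ ∷ []
    s₃-pick = positive-task v nz _ (s≤s (s≤s (s≤s z≤n)))
    s₃ : Fin k
    s₃ = proj₁ s₃-pick
    s₃>0 : 0 < proj₁ v s₃
    s₃>0 = proj₁ (proj₂ s₃-pick)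
    s₃∉ : s₃ ∉ s₁ ∷ s₂ ∷ []
    s₃∉ = proj₂ (proj₂ s₃-pick)
    w-pick : ∃ λ w → 0 < proj₁ v w × w ∉ s₁ ∷ s₂ ∷ s₃ ∷ []
    w-pick = positive-task v nz _ (s≤s (s≤s (s≤s (s≤s z≤n))))
    w : Fin k
    w = proj₁ w-pick
    w>0 : 0 < proj₁ v w
    w>0 = proj₁ (proj₂ w-pick)
    w∉ : w ∉ s₁ ∷ s₂ ∷ s₃ ∷ []
    w∉ = proj₂ (proj₂ w-pick)

  by-cases : Dec (0 < proj₁ v t') → Dec (0 < proj₁ v t) → Configuration v t t' ⊎ Configuration v t' t
  by-cases (yes t'>0) _ = inj₁ (with-target t≢t' t'>0 (s₁∉ ∘ here) (s₁∉ ∘ there ∘ here)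
    (s₂∉ ∘ here) (s₂∉ ∘ there ∘ here) (z∉ ∘ here) (z∉ ∘ there ∘ here))
  by-cases (no _) (yes t>0) = inj₂ (with-target (≢-sym t≢t') t>0 (s₁∉ ∘ there ∘ here) (s₁∉ ∘ here)
    (s₂∉ ∘ there ∘ here) (s₂∉ ∘ here) (z∉ ∘ there ∘ here) (z∉ ∘ here))
  by-cases (no t'≯0) (no t≯0) = inj₁ (without-target t'≯0 t≯0)

lemma18 : (n k : ℕ) → 4 ≤ n → 5 ≤ k → (f : Allocation n k) → Valid f →
    MaxSwitchCostAtMost f 2 → (v : DemandVec n k) → 4 ≤ nonZeroCount v →
    (t t' : Fin k) → Type1 f v t → Type1 f v t' → t ≡ t'
lemma18 n k _ k≥5 f valid maxsc v nz t t' t-type1 t'-type1 with t ≟ t'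
... | yes t≡t' = t≡t'
... | no t≢t' with configuration k≥5 nz t≢t'
...   | inj₁ c = ⊥-elim (Contradiction.absurd valid maxsc c t-type1 t'-type1)
...   | inj₂ c = ⊥-elim (Contradiction.absurd valid maxsc c t'-type1 t-type1)
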